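{- Let $\lambda$ be a non-empty charged partition with abacus $A$, let $m=\min(\mathbb Z\setminus A)$ and let $x\in A$ with $x>m$. Set $h=x-m\ge1$ and let $R$ be the $h$-rim hook of $\lambda$ whose removal yields the charged partition with abacus $(A\setminus\{x\})\cup\{m\}$. Then $R$ has exactly one node in the first column of $Y(\lambda)$ if and only if $x=m+1$ or $m+1\notin A$.
   Context: A $c$-charged partition is a partition $\lambda=(\lambda_1\ge\dots\ge\lambda_h>0)$ with an integer $c$; $Y(\lambda)=\{(a,b):1\le a\le h,1\le b\le\lambda_a\}$; its abacus is $\{\lambda_k-k+c+1:k\ge1\}$ ($\lambda_k=0$ for $k>h$), and every subset of $\mathbb Z$ containing all sufficiently negative and no sufficiently large integers is the abacus of a unique charged partition. For $\gamma=(a,b)\in Y(\lambda)$, the rim hook $R^\lambda_\gamma=\{(x,y)\in Y(\lambda):x\ge a,y\ge b,(x+1,y+1)\notin Y(\lambda)\}$; it is an $h$-rim hook if it has $h$ nodes; removing it gives the partition with diagram $Y(\lambda)\setminus R^\lambda_\gamma$ (same charge). It is a known fact that for $x\in A$ with $x-h\notin A$ there is an $h$-rim hook of $\lambda$ whose removal gives the charged partition with abacus $(A\setminus\{x\})\cup\{x-h\}$. -}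

module Defs where

open import Data.Nat using (ℕ; zero; suc; _≤_; _<_; _≥_; _≤?_)
open import Data.Integer as ℤ using (ℤ; +_)
open import Data.List using (List; []; _∷_; length; map; upTo; concatMap; filter)
open import Data.List.Relation.Unary.Linked using (Linked)
open import Data.List.Relation.Unary.All using (All)
open import Data.Product using (Σ; ∃; ∃-syntax; _×_; _,_)
open import Relation.Nullary using (¬_; Dec)
open import Relation.Nullary.Decidable using (_×-dec_; ¬?)
open import Relation.Binary.PropositionalEquality using (_≡_)

record Partition : Set where
  constructor mkPartition
  field
    parts    : List ℕ
    nonincr  : Linked _≥_ parts
    positive : All (λ p → 0 < p) parts
open Partition public

len : Partition → ℕ
len p = length (parts p)

-- λ_k for k ≥ 1 (1-indexed), with λ_k = 0 for k > h.  (k = 0 is unused.)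
partAt : List ℕ → ℕ → ℕ
partAt []       _             = 0
partAt (p ∷ ps) zero          = 0
partAt (p ∷ ps) (suc zero)    = p
partAt (p ∷ ps) (suc (suc k)) = partAt ps (suc k)

part : Partition → ℕ → ℕ
part p k = partAt (parts p) k

Node : Set
Node = ℕ × ℕ

InY : Partition → Node → Set
InY la (a , b) = (1 ≤ a × a ≤ len la) × (1 ≤ b × b ≤ part la a)

InY? : (la : Partition) (n : Node) → Dec (InY la n)
InY? la (a , b) = ((1 ≤? a) ×-dec (a ≤? len la)) ×-dec ((1 ≤? b) ×-dec (b ≤? part la a))

InRim : Partition → Node → Node → Set
InRim la (a , b) (x , y) = InY la (x , y) × (a ≤ x × b ≤ y) × ¬ InY la (suc x , suc y)

InRim? : (la : Partition) (γ n : Node) → Dec (InRim la γ n)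
InRim? la (a , b) (x , y) =
  InY? la (x , y) ×-dec (((a ≤? x) ×-dec (b ≤? y)) ×-dec ¬? (InY? la (suc x , suc y)))

oneTo : ℕ → List ℕ
oneTo n = map suc (upTo n)

nodesY : Partition → List Node
nodesY la = concatMap (λ a → map (λ b → (a , b)) (oneTo (part la a))) (oneTo (len la))

rimSize : Partition → Node → ℕ
rimSize la γ = length (filter (InRim? la γ) (nodesY la))

rimFirstColumn : Partition → Node → ℕ
rimFirstColumn la γ = length (filter (λ a → InRim? la γ (a , 1)) (oneTo (len la)))

InAbacus : Partition → ℤ → ℤ → Set
InAbacus la c z = ∃[ k ] (1 ≤ k × z ≡ (((+ part la k) ℤ.- (+ k)) ℤ.+ c) ℤ.+ + 1)

IsMinNotInAbacus : Partition → ℤ → ℤ → Set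
IsMinNotInAbacus la c m = ¬ InAbacus la c m × (∀ z → z ℤ.< m → InAbacus la c z)

-- Let h be the number of parts. Row k carries the bead λ_k − k + c + 1, so the
-- first gap of the abacus is m = c + 1 − h, and m + 1 is a bead exactly when
-- λ_h = 1. The node (h,1) lies on the hook: otherwise the smaller partition
-- still has h rows, hence the same first gap m, yet m is one of its beads.
-- If (h,1) is the only first-column node of the hook and x ≠ m + 1, the
-- smaller partition has h − 1 rows, so its first gap is m + 1, which is
-- therefore not a bead of λ. Conversely, x = m + 1 makes the hook a single
-- node, and m + 1 ∉ A forces λ_h ≥ 2, so for every row a < h the node
-- (a + 1, 2) lies in Y(λ) and (a,1) is not on the rim.
module Submission where

open import Defs
open import Data.Integer as ℤ using (ℤ; +_; ∣_∣; +[1+_]; -[1+_])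
open import Data.List using ([])
open import Data.Product using (_×_; _,_)
open import Data.Sum using (_⊎_)
open import Function.Bundles using (_⇔_)
open import Relation.Nullary using (¬_)
open import Relation.Binary.PropositionalEquality using (_≡_; _≢_)

open import Data.Nat using (ℕ; _≟_; zero; suc; _≤_; _<_; _≥_; z≤n; s≤s; _+_)
open import Data.Nat.Properties
  using (≤-refl; ≤-pred; +-comm; ≤-reflexive; m<n+m; ≤-trans; ≤-antisym; n≤1+n; 1+n≰n; <⇒≱; ≮⇒≥; <-irrefl; m≤n+m; m<m+n; suc-injective)
import Data.Integer.Properties as ℤ
open import Data.Integer.Tactic.RingSolver using (solve-∀)
open import Data.List using (_∷_; length; map; upTo; filter; _++_; [_])
open import Data.List.Properties using (upTo-∷ʳ; map-++; filter-++; filter-accept; filter-some; filter-none; length-++)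
open import Data.List.Membership.Propositional using (_∈_; lose)
open import Data.List.Membership.Propositional.Properties
  using (∈-map⁺; ∈-map⁻; ∈-upTo⁺; ∈-upTo⁻; ∈-concatMap⁺; ∈-filter⁺; ∈-length)
open import Data.List.Relation.Unary.Any as Any using (here; there)
open import Data.List.Relation.Unary.All as All using (All; _∷_)
open import Data.List.Relation.Unary.Linked using (Linked; [-]; _∷_)
open import Data.Product using (∃; proj₁; proj₂)
open import Data.Product.Properties using (≡-dec)
open import Data.Sum using (inj₁; inj₂)
open import Relation.Nullary using (yes; no; contradiction)
open import Relation.Unary using (Pred; Decidable)
open import Relation.Binary.PropositionalEquality using (refl; sym; trans; cong; cong₂; subst; module ≡-Reasoning)
open import Relation.Binary using (tri<; tri≈; tri>)
open import Function using (_∘_)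
open import Function.Bundles using (Equivalence; mk⇔)
import Level

bead : ℤ → ℕ → ℕ → ℤ
bead c a k = (((+ a) ℤ.- (+ k)) ℤ.+ c) ℤ.+ + 1

bead-injective : ∀ c {a k a′ k′} → bead c a k ≡ bead c a′ k′ → a + k′ ≡ a′ + k
bead-injective c {a} {k} {a′} {k′} eq = ℤ.+-injective (begin
    + (a + k′)                 ≡⟨ ℤ.pos-+ a k′ ⟩
    + a ℤ.+ + k′               ≡⟨ undoˡ (+ a) (+ k) (+ k′) c ⟩
    bead c a k ℤ.+ offset      ≡⟨ cong (ℤ._+ offset) eq ⟩
    bead c a′ k′ ℤ.+ offset    ≡⟨ sym (undoʳ (+ a′) (+ k) (+ k′) c) ⟩
    + a′ ℤ.+ + k               ≡⟨ sym (ℤ.pos-+ a′ k) ⟩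
    + (a′ + k)                 ∎)
  where
  open ≡-Reasoning
  offset : ℤ
  offset = + k ℤ.+ + k′ ℤ.- c ℤ.- + 1
  undoˡ : ∀ A K K′ C → A ℤ.+ K′ ≡ (((A ℤ.- K) ℤ.+ C) ℤ.+ + 1) ℤ.+ (K ℤ.+ K′ ℤ.- C ℤ.- + 1)
  undoˡ = solve-∀
  undoʳ : ∀ A K K′ C → A ℤ.+ K ≡ (((A ℤ.- K′) ℤ.+ C) ℤ.+ + 1) ℤ.+ (K ℤ.+ K′ ℤ.- C ℤ.- + 1)
  undoʳ = solve-∀

bead-+1 : ∀ c a k → bead c a k ℤ.+ + 1 ≡ bead c (suc a) k
bead-+1 c a k = trans (shift (+ a) (+ k) c) (cong (λ A → ((A ℤ.- + k) ℤ.+ c) ℤ.+ + 1) (sym (ℤ.pos-+ 1 a)))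
  where
  shift : ∀ A K C → (((A ℤ.- K) ℤ.+ C) ℤ.+ + 1) ℤ.+ + 1 ≡ (((+ 1 ℤ.+ A) ℤ.- K) ℤ.+ C) ℤ.+ + 1
  shift = solve-∀

bead-suc-suc : ∀ c a k → bead c (suc a) (suc k) ≡ bead c a k
bead-suc-suc c a k = begin
    bead c (suc a) (suc k)                              ≡⟨ cong₂ (λ A K → ((A ℤ.- K) ℤ.+ c) ℤ.+ + 1) (ℤ.pos-+ 1 a) (ℤ.pos-+ 1 k) ⟩
    (((+ 1 ℤ.+ + a) ℤ.- (+ 1 ℤ.+ + k)) ℤ.+ c) ℤ.+ + 1   ≡⟨ cancel (+ a) (+ k) c ⟩
    bead c a k                                          ∎
  where
  open ≡-Reasoning
  cancel : ∀ A K C → (((+ 1 ℤ.+ A) ℤ.- (+ 1 ℤ.+ K)) ℤ.+ C) ℤ.+ + 1 ≡ ((A ℤ.- K) ℤ.+ C) ℤ.+ + 1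
  cancel = solve-∀

m+1-m≡1 : ∀ m → (m ℤ.+ + 1) ℤ.- m ≡ + 1
m+1-m≡1 = solve-∀

m<n⇒0<n-m : ∀ {z w} → z ℤ.< w → + 0 ℤ.< w ℤ.- z
m<n⇒0<n-m {z} {w} z<w = subst (ℤ._< w ℤ.- z) (ℤ.+-inverseʳ z) (ℤ.+-monoˡ-< (ℤ.- z) z<w)

bead-below : ∀ c k z → z ℤ.< bead c 0 k → ∃ λ j → z ≡ bead c 0 (k + suc j)
bead-below c k z z< with bead c 0 k ℤ.- z in gap | m<n⇒0<n-m z<
... | +[1+ j ] | _ = j , (begin
    z                                             ≡⟨ regroup z (bead c 0 k) ⟩
    bead c 0 k ℤ.- (bead c 0 k ℤ.- z)             ≡⟨ cong (λ d → bead c 0 k ℤ.- d) gap ⟩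
    bead c 0 k ℤ.- + suc j                        ≡⟨ lower (+ k) (+ suc j) c ⟩
    ((+ 0 ℤ.- (+ k ℤ.+ + suc j)) ℤ.+ c) ℤ.+ + 1   ≡⟨ cong (λ K → ((+ 0 ℤ.- K) ℤ.+ c) ℤ.+ + 1) (sym (ℤ.pos-+ k (suc j))) ⟩
    bead c 0 (k + suc j)                          ∎)
  where
  open ≡-Reasoning
  regroup : ∀ Z W → Z ≡ W ℤ.- (W ℤ.- Z)
  regroup = solve-∀
  lower : ∀ K J C → (((+ 0 ℤ.- K) ℤ.+ C) ℤ.+ + 1) ℤ.- J ≡ ((+ 0 ℤ.- (K ℤ.+ J)) ℤ.+ C) ℤ.+ + 1
  lower = solve-∀
... | + 0 | ℤ.+<+ ()
... | -[1+ _ ] | ()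

∈-oneTo⁺ : ∀ {a n} → 1 ≤ a → a ≤ n → a ∈ oneTo n
∈-oneTo⁺ {suc a} _ a<n = ∈-map⁺ suc (∈-upTo⁺ a<n)

∈-oneTo⁻ : ∀ {a n} → a ∈ oneTo n → 1 ≤ a × a ≤ n
∈-oneTo⁻ a∈ with ∈-map⁻ suc a∈
... | b , b∈ , refl = s≤s z≤n , ∈-upTo⁻ b∈

oneTo-suc : ∀ n → oneTo (suc n) ≡ oneTo n ++ [ suc n ]
oneTo-suc n = trans (cong (map suc) (sym (upTo-∷ʳ n))) (map-++ suc (upTo n) [ n ])

partAt-pos : ∀ {ps} → All (λ p → 0 < p) ps → ∀ {k} → 1 ≤ k → k ≤ length ps → 1 ≤ partAt ps k
partAt-pos (p>0 ∷ _)  {suc zero}    _ _         = p>0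
partAt-pos (_ ∷ ps>0) {suc (suc k)} _ (s≤s k≤) = partAt-pos ps>0 (s≤s z≤n) k≤

partAt-pos⇒≤length : ∀ ps {k} → 1 ≤ partAt ps k → k ≤ length ps
partAt-pos⇒≤length (p ∷ ps) {zero}        _   = z≤n
partAt-pos⇒≤length (p ∷ ps) {suc zero}    _   = s≤s z≤n
partAt-pos⇒≤length (p ∷ ps) {suc (suc k)} pos = s≤s (partAt-pos⇒≤length ps pos)

partAt-beyond : ∀ ps {k} → length ps < k → partAt ps k ≡ 0
partAt-beyond []       _                          = refl
partAt-beyond (p ∷ ps) {suc (suc k)} (s≤s len<k) = partAt-beyond ps len<k

partAt-≤head : ∀ {p ps} → Linked _≥_ (p ∷ ps) → ∀ k → partAt (p ∷ ps) k ≤ p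
partAt-≤head _               zero          = z≤n
partAt-≤head _               (suc zero)    = ≤-refl
partAt-≤head [-]             (suc (suc k)) = z≤n
partAt-≤head (p≥q ∷ ordered) (suc (suc k)) = ≤-trans (partAt-≤head ordered (suc k)) p≥q

partAt-antitone : ∀ {ps} → Linked _≥_ ps → ∀ {i j} → 1 ≤ i → i ≤ j → partAt ps j ≤ partAt ps i
partAt-antitone {[]}         _             _ _               = z≤n
partAt-antitone {p ∷ ps}     ordered {suc zero} {j} _ _      = partAt-≤head ordered j
partAt-antitone {p ∷ ps}     _ {suc (suc i)} {suc zero} _ (s≤s ())
partAt-antitone {p ∷ []}     _ {suc (suc i)} {suc (suc j)} _ _ = z≤n
partAt-antitone {p ∷ q ∷ qs} (_ ∷ ordered) {suc (suc i)} {suc (suc j)} _ (s≤s i≤j) =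
  partAt-antitone ordered (s≤s z≤n) i≤j

InY-firstColumn : ∀ p {k} → 1 ≤ k → k ≤ len p → InY p (k , 1)
InY-firstColumn p 1≤k k≤len = (1≤k , k≤len) , (s≤s z≤n , partAt-pos (positive p) 1≤k k≤len)

∈-nodesY : ∀ p {a b} → InY p (a , b) → (a , b) ∈ nodesY p
∈-nodesY p {a} ((1≤a , a≤len) , (1≤b , b≤part)) =
  ∈-concatMap⁺ (λ a → map (λ b → (a , b)) (oneTo (part p a)))
    (Any.map (λ { refl → ∈-map⁺ (λ b → (a , b)) (∈-oneTo⁺ 1≤b b≤part) }) (∈-oneTo⁺ 1≤a a≤len))

suc-len-firstColumn : ∀ p {n} → 1 ≤ n → (∀ {a} → 1 ≤ a → a < n → InY p (a , 1)) → ¬ InY p (n , 1)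
  → suc (len p) ≡ n
suc-len-firstColumn p {suc n} _ column gap =
  cong suc (≤-antisym (≮⇒≥ (gap ∘ InY-firstColumn p (s≤s z≤n))) (rowExists ≤-refl))
  where
  rowExists : ∀ {i} → i < suc n → i ≤ len p
  rowExists {zero}  _   = z≤n
  rowExists {suc i} i<n = proj₂ (proj₁ (column (s≤s z≤n) i<n))

row≢firstGap : ∀ p {k} → 1 ≤ k → k ≢ part p k + len p
row≢firstGap p {k} 1≤k with part p k in λk
... | zero  = λ k≡len → contradiction (subst (1 ≤_) λk (partAt-pos (positive p) 1≤k (≤-reflexive k≡len))) λ ()
... | suc t = λ k≡ → <⇒≱ (m<n+m (len p) (s≤s z≤n))
                         (subst (_≤ len p) k≡ (partAt-pos⇒≤length (parts p) (subst (1 ≤_) (sym λk) (s≤s z≤n))))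

firstGap-∉ : ∀ p c → ¬ InAbacus p c (bead c 0 (len p))
firstGap-∉ p c (k , 1≤k , eq) = row≢firstGap p 1≤k (bead-injective c {0} {len p} {part p k} {k} eq)

firstGap-below : ∀ p c {z} → z ℤ.< bead c 0 (len p) → InAbacus p c z
firstGap-below p c {z} z< with bead-below c (len p) z z<
... | j , z≡ = len p + suc j , ≤-trans (s≤s z≤n) (m≤n+m (suc j) (len p)) ,
               trans z≡ (cong (λ a → bead c a (len p + suc j)) (sym (partAt-beyond (parts p) (m<m+n (len p) (s≤s z≤n)))))

minNotInAbacus≡firstGap : ∀ p c {m} → IsMinNotInAbacus p c m → m ≡ bead c 0 (len p)
minNotInAbacus≡firstGap p c {m} (m∉ , below∈) with ℤ.<-cmp m (bead c 0 (len p))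
... | tri< m< _ _ = contradiction (firstGap-below p c m<) m∉
... | tri≈ _ m≡ _ = m≡
... | tri> _ _ m> = contradiction (below∈ _ m>) (firstGap-∉ p c)

distinct∈⇒2≤length : ∀ {A : Set} {a b : A} {xs} → a ∈ xs → b ∈ xs → a ≢ b → 2 ≤ length xs
distinct∈⇒2≤length (here refl) (here refl) a≢b = contradiction refl a≢b
distinct∈⇒2≤length (here _)    (there b∈)  _   = s≤s (∈-length b∈)
distinct∈⇒2≤length (there a∈)  (here _)    _   = s≤s (∈-length a∈)
distinct∈⇒2≤length (there a∈)  (there b∈)  a≢b = ≤-trans (distinct∈⇒2≤length a∈ b∈ a≢b) (n≤1+n _)

module _ {P : Pred ℕ Level.zero} (P? : Decidable P) where

  length-filter-oneTo≡1⇔ : ∀ {n} → 1 ≤ n → P n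
    → length (filter P? (oneTo n)) ≡ 1 ⇔ (∀ {a} → 1 ≤ a → a < n → ¬ P a)
  length-filter-oneTo≡1⇔ {suc n} _ Pn = mk⇔ onlyLast fromOnlyLast
    where
    open ≡-Reasoning
    below : ℕ
    below = length (filter P? (oneTo n))

    split : length (filter P? (oneTo (suc n))) ≡ suc below
    split = begin
      length (filter P? (oneTo (suc n)))                    ≡⟨ cong (length ∘ filter P?) (oneTo-suc n) ⟩
      length (filter P? (oneTo n ++ [ suc n ]))             ≡⟨ cong length (filter-++ P? (oneTo n) [ suc n ]) ⟩
      length (filter P? (oneTo n) ++ filter P? [ suc n ])   ≡⟨ length-++ (filter P? (oneTo n)) ⟩
      below + length (filter P? [ suc n ])                  ≡⟨ cong (λ ys → below + length ys) (filter-accept P? Pn) ⟩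
      below + 1                                             ≡⟨ +-comm below 1 ⟩
      suc below                                             ∎

    onlyLast : length (filter P? (oneTo (suc n))) ≡ 1 → ∀ {a} → 1 ≤ a → a < suc n → ¬ P a
    onlyLast one 1≤a (s≤s a≤n) Pa =
      contradiction (subst (0 <_) (suc-injective (trans (sym split) one)) (filter-some P? (lose (∈-oneTo⁺ 1≤a a≤n) Pa))) λ ()

    fromOnlyLast : (∀ {a} → 1 ≤ a → a < suc n → ¬ P a) → length (filter P? (oneTo (suc n))) ≡ 1
    fromOnlyLast notP = trans split (cong (suc ∘ length) (filter-none P? (All.tabulate λ a∈ →
      let (1≤a , a≤n) = ∈-oneTo⁻ a∈ in notP 1≤a (s≤s a≤n))))

lastRow∈Rim : ∀ la {a b} → InY la (a , b) → b ≤ 1 → InRim la (a , b) (len la , 1)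
lastRow∈Rim la ((1≤a , a≤len) , _) b≤1 =
  InY-firstColumn la (≤-trans 1≤a a≤len) ≤-refl , (a≤len , b≤1) , λ below → 1+n≰n (proj₂ (proj₁ below))

firstColumn∉Rim : ∀ la γ {a} → 2 ≤ part la (suc a) → ¬ InRim la γ (a , 1)
firstColumn∉Rim la γ λ≥2 (_ , _ , notInside) =
  notInside ((s≤s z≤n , partAt-pos⇒≤length (parts la) (≤-trans (s≤s z≤n) λ≥2)) , (s≤s z≤n , λ≥2))

2≤lastPart : ∀ p c → 1 ≤ len p → ¬ InAbacus p c (bead c 1 (len p)) → 2 ≤ part p (len p)
2≤lastPart p c 1≤len notBead with part p (len p) in λh | partAt-pos (positive p) 1≤len ≤-refl
... | zero        | ()
... | suc zero    | _ = contradiction (len p , 1≤len , cong (λ a → bead c a (len p)) (sym λh)) notBead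
... | suc (suc _) | _ = s≤s (s≤s z≤n)

rimSize≡1⇒unique : ∀ la γ {n n′} → rimSize la γ ≡ 1 → InRim la γ n → InRim la γ n′ → n ≡ n′
rimSize≡1⇒unique la γ {n} {n′} one n∈R n′∈R with ≡-dec _≟_ _≟_ n n′
... | yes n≡n′ = n≡n′
... | no  n≢n′ = contradiction (subst (2 ≤_) one twoNodes) 1+n≰n
  where
  twoNodes : 2 ≤ rimSize la γ
  twoNodes = distinct∈⇒2≤length (∈-filter⁺ (InRim? la γ) (∈-nodesY la (proj₁ n∈R)) n∈R)
                                 (∈-filter⁺ (InRim? la γ) (∈-nodesY la (proj₁ n′∈R)) n′∈R) n≢n′

module _ (la mu : Partition) (γ : Node) (muY : ∀ n → InY mu n ⇔ (InY la n × ¬ InRim la γ n)) where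
  open Equivalence

  suc-len-afterRemoval : ∀ {n} → 1 ≤ n → n ≤ suc (len la) → (∀ {a} → 1 ≤ a → a < n → ¬ InRim la γ (a , 1))
    → ¬ InY mu (n , 1) → suc (len mu) ≡ n
  suc-len-afterRemoval 1≤n n≤ offHook = suc-len-firstColumn mu 1≤n
    (λ 1≤a a<n → from (muY _) (InY-firstColumn la 1≤a (≤-pred (≤-trans a<n n≤)) , offHook 1≤a a<n))

  lastRow∈Rim-afterRemoval : ∀ c → InY la γ → InAbacus mu c (bead c 0 (len la)) → InRim la γ (len la , 1)
  lastRow∈Rim-afterRemoval c γ∈Y gap∈ = lastRow∈Rim la γ∈Y (≮⇒≥ λ 1<b → firstGap-∉ mu c
      (subst (InAbacus mu c) (cong (bead c 0) (sym (suc-injective (sameRows 1<b)))) gap∈))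
    where
    sameRows : 1 < proj₂ γ → suc (len mu) ≡ suc (len la)
    sameRows 1<b = suc-len-afterRemoval (s≤s z≤n) ≤-refl
      (λ _ _ onHook → <⇒≱ 1<b (proj₂ (proj₁ (proj₂ onHook))))
      (λ beyond → 1+n≰n (proj₂ (proj₁ (proj₁ (to (muY _) beyond)))))

  -- μ then has one row fewer, and bead c 1 h is the first gap of its abacus.
  bead1-∉-afterRemoval : ∀ c → 1 ≤ len la → InRim la γ (len la , 1)
    → (∀ {a} → 1 ≤ a → a < len la → ¬ InRim la γ (a , 1)) → ¬ InAbacus mu c (bead c 1 (len la))
  bead1-∉-afterRemoval c 1≤h h∈R offHook = firstGap-∉ mu c ∘ subst (InAbacus mu c) (begin
      bead c 1 (len la)        ≡⟨ cong (bead c 1) (sym fewerRows) ⟩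
      bead c 1 (suc (len mu))  ≡⟨ bead-suc-suc c 0 (len mu) ⟩
      bead c 0 (len mu)        ∎)
    where
    open ≡-Reasoning
    fewerRows : suc (len mu) ≡ len la
    fewerRows = suc-len-afterRemoval 1≤h (n≤1+n _) offHook (λ h∈mu → proj₂ (to (muY _) h∈mu) h∈R)

-- The hypotheses parts la ≢ [], x ∈ A and m < x only ensure that the hook
-- exists.
lemma4p16 : (la : Partition) (c : ℤ) → parts la ≢ []
    → (m : ℤ) → IsMinNotInAbacus la c m
    → (x : ℤ) → InAbacus la c x → m ℤ.< x
    → (γ : Node) → InY la γ → rimSize la γ ≡ ∣ x ℤ.- m ∣
    → (mu : Partition)
    → (∀ n → InY mu n ⇔ (InY la n × ¬ InRim la γ n))
    → (∀ z → InAbacus mu c z ⇔ ((InAbacus la c z × z ≢ x) ⊎ z ≡ m))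
    → (rimFirstColumn la γ ≡ 1) ⇔ (x ≡ m ℤ.+ + 1 ⊎ ¬ InAbacus la c (m ℤ.+ + 1))
lemma4p16 la c _ m isMin x _ _ γ γ∈Y size mu muY muA = mk⇔ onlyLast⇒ (from onlyLast⇔ ∘ ⇒onlyLast)
  where
  open Equivalence
  1≤h : 1 ≤ len la
  1≤h = ≤-trans (proj₁ (proj₁ γ∈Y)) (proj₂ (proj₁ γ∈Y))
  m≡ : m ≡ bead c 0 (len la)
  m≡ = minNotInAbacus≡firstGap la c isMin
  m+1≡ : m ℤ.+ + 1 ≡ bead c 1 (len la)
  m+1≡ = trans (cong (ℤ._+ + 1) m≡) (bead-+1 c 0 (len la))
  h∈R : InRim la γ (len la , 1)
  h∈R = lastRow∈Rim-afterRemoval la mu γ muY c γ∈Y (subst (InAbacus mu c) m≡ (from (muA m) (inj₂ refl)))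
  onlyLast⇔ : rimFirstColumn la γ ≡ 1 ⇔ (∀ {a} → 1 ≤ a → a < len la → ¬ InRim la γ (a , 1))
  onlyLast⇔ = length-filter-oneTo≡1⇔ (λ a → InRim? la γ (a , 1)) 1≤h h∈R

  onlyLast⇒ : rimFirstColumn la γ ≡ 1 → x ≡ m ℤ.+ + 1 ⊎ ¬ InAbacus la c (m ℤ.+ + 1)
  onlyLast⇒ one with x ℤ.≟ m ℤ.+ + 1
  ... | yes x≡ = inj₁ x≡
  ... | no  x≢ = inj₂ λ m+1∈ → bead1-∉-afterRemoval la mu γ muY c 1≤h h∈R (to onlyLast⇔ one)
                                 (subst (InAbacus mu c) m+1≡ (from (muA _) (inj₁ (m+1∈ , x≢ ∘ sym))))

  ⇒onlyLast : x ≡ m ℤ.+ + 1 ⊎ ¬ InAbacus la c (m ℤ.+ + 1) → ∀ {a} → 1 ≤ a → a < len la → ¬ InRim la γ (a , 1)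
  ⇒onlyLast (inj₁ x≡) _ a<h a∈R = <-irrefl (cong proj₁ (rimSize≡1⇒unique la γ singleton a∈R h∈R)) a<h
    where
    singleton : rimSize la γ ≡ 1
    singleton = trans size (cong ∣_∣ (trans (cong (ℤ._- m) x≡) (m+1-m≡1 m)))
  ⇒onlyLast (inj₂ m+1∉) _ a<h = firstColumn∉Rim la γ (≤-trans
    (2≤lastPart la c 1≤h (m+1∉ ∘ subst (InAbacus la c) (sym m+1≡))) (partAt-antitone (nonincr la) (s≤s z≤n) a<h))
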